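{- Let $m\ge 1$ and $\Delta\ge 1$ be integers. For every assignment of non-negative real numbers to the cells of an $m\times m$ table, the maximum total value of a set of pairwise non-conflicting $\Delta$-multisegments (where the set ranges over all sets of $\Delta$-multisegments of the table) is at least $\frac{\Delta-1}{\Delta}$ times the score of the table.
   Context: Consider an $m\times m$ table of cells. A segment is a nonempty set of consecutive cells lying in a single row (horizontal) or a single column (vertical); a single cell is both. The first cell of a horizontal (vertical) segment is its leftmost (bottommost) cell, its last cell is its rightmost (topmost) cell. A segment $A$ precedes a segment $B$ if every cell of $A$ is strictly higher than and strictly to the right of every cell of $B$; two segments are non-conflicting if one precedes the other. A $\Delta$-multisegment is a sequence of $\Delta$ segments $s_1,\dots,s_\Delta$ such that for each $1\le i\le\Delta-1$ the last cell of $s_i$ coincides with the first cell of $s_{i+1}$; it covers a cell if one of its segments does. Two multisegments $S_1,S_2$ are non-conflicting if every segment of $S_1$ and every segment of $S_2$ are non-conflicting. Given non-negative numbers on the cells, the value of a multisegment is the sum of the numbers on the cells it covers, and the score of the table is the maximum sum of numbers over the cells of a path of $2m-1$ cells from the bottom-left cell to the top-right cell that always moves one cell up or one cell right.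
   Formalization: The numbers assigned to the cells of the table are non-negative rationals instead of non-negative real numbers. -}

module Defs where

open import Data.Nat as ℕ using (ℕ; zero; suc; _∸_; _<_; _≤_)
open import Data.Fin as Fin using (Fin; toℕ)
open import Data.Bool using (Bool; true; false; _∧_; _∨_; if_then_else_; T)
open import Data.Product using (_×_; _,_; proj₁; proj₂; ∃)
open import Data.List as List using (List; []; _∷_; map; foldr; concatMap; allFin; filterᵇ)
open import Data.Vec as Vec using (Vec)
open import Data.Rational as ℚ using (ℚ; 0ℚ; _+_; _⊔_)
open import Relation.Binary.PropositionalEquality using (_≡_)
open import Relation.Nullary using (yes; no)

-- The m × m table.  A cell is (column , row): column 0 is the leftmost,
-- row 0 is the bottommost.  "Right" = larger column, "higher" = larger row.

Cell : ℕ → Set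
Cell m = Fin m × Fin m

col row : ∀ {m} → Cell m → ℕ
col c = toℕ (proj₁ c)
row c = toℕ (proj₂ c)

-- Segments.  hor y a b : cells (a,y),(a+1,y),…,(b,y)  with a ≤ b.
--            ver x a b : cells (x,a),(x,a+1),…,(x,b)  with a ≤ b.
-- A single cell can be written either way (it is both).

data Segment (m : ℕ) : Set where
  hor : (y a b : Fin m) → toℕ a ≤ toℕ b → Segment m
  ver : (x a b : Fin m) → toℕ a ≤ toℕ b → Segment m

first : ∀ {m} → Segment m → Cell m
first (hor y a b _) = (a , y)
first (ver x a b _) = (x , a)

last : ∀ {m} → Segment m → Cell m
last (hor y a b _) = (b , y)
last (ver x a b _) = (x , b)

inSegᵇ : ∀ {m} → Cell m → Segment m → Bool
inSegᵇ c (hor y a b _) = (row c ℕ.≡ᵇ toℕ y) ∧ ((toℕ a ℕ.≤ᵇ col c) ∧ (col c ℕ.≤ᵇ toℕ b))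
inSegᵇ c (ver x a b _) = (col c ℕ.≡ᵇ toℕ x) ∧ ((toℕ a ℕ.≤ᵇ row c) ∧ (row c ℕ.≤ᵇ toℕ b))

InSeg : ∀ {m} → Cell m → Segment m → Set
InSeg c s = T (inSegᵇ c s)

Precedes : ∀ {m} → Segment m → Segment m → Set
Precedes {m} A B = ∀ (c d : Cell m) → InSeg c A → InSeg d B →
  (row d < row c) × (col d < col c)

NonConflictingSeg : ∀ {m} → Segment m → Segment m → Set
NonConflictingSeg A B = Precedes A B Data.Sum.⊎ Precedes B A
  where import Data.Sum

record Multiseg (m Δ : ℕ) : Set where
  constructor mseg
  field
    seg   : Fin Δ → Segment m
    chain : ∀ (i j : Fin Δ) → toℕ j ≡ suc (toℕ i) → last (seg i) ≡ first (seg j)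
open Multiseg public

coversᵇ : ∀ {m Δ} → Multiseg m Δ → Cell m → Bool
coversᵇ {Δ = Δ} S c = foldr (λ i acc → inSegᵇ c (seg S i) ∨ acc) false (allFin Δ)

NonConflicting : ∀ {m Δ} → Multiseg m Δ → Multiseg m Δ → Set
NonConflicting {Δ = Δ} S₁ S₂ = ∀ (i j : Fin Δ) → NonConflictingSeg (seg S₁ i) (seg S₂ j)

Weights : ℕ → Set
Weights m = Cell m → ℚ

sumℚ : List ℚ → ℚ
sumℚ = foldr _+_ 0ℚ

allCells : (m : ℕ) → List (Cell m)
allCells m = concatMap (λ x → map (λ y → (x , y)) (allFin m)) (allFin m)

value : ∀ {m Δ} → Weights m → Multiseg m Δ → ℚ
value {m} w S = sumℚ (map (λ c → if coversᵇ S c then w c else 0ℚ) (allCells m))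

totalValue : ∀ {m Δ} → Weights m → List (Multiseg m Δ) → ℚ
totalValue w Ss = sumℚ (map (value w) Ss)

-- A path is a word of 2(m-1) moves
-- (true = right, false = up) containing exactly m-1 right moves; it
-- visits 2m-1 cells.

weightAt : ∀ {m} → Weights m → ℕ → ℕ → ℚ
weightAt {m} w x y with x ℕ.<? m | y ℕ.<? m
... | yes p | yes q = w (Fin.fromℕ< p , Fin.fromℕ< q)
... | _ | _ = 0ℚ

pathSumFrom : ∀ {m} → Weights m → ℕ → ℕ → List Bool → ℚ
pathSumFrom w x y [] = weightAt w x y
pathSumFrom w x y (true  ∷ ms) = weightAt w x y + pathSumFrom w (suc x) y ms
pathSumFrom w x y (false ∷ ms) = weightAt w x y + pathSumFrom w x (suc y) ms

countRight : List Bool → ℕ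
countRight [] = 0
countRight (true ∷ ms) = suc (countRight ms)
countRight (false ∷ ms) = countRight ms

words : ℕ → List (List Bool)
words zero = [] ∷ []
words (suc n) = map (true ∷_) (words n) List.++ map (false ∷_) (words n)

paths : ℕ → List (List Bool)
paths m = filterᵇ (λ ms → countRight ms ℕ.≡ᵇ (m ∸ 1)) (words (2 ℕ.* (m ∸ 1)))

-- score of the table: maximum path sum (weights are non-negative, and
-- there is at least one path, so starting the max at 0 is harmless)
score : ∀ {m} → Weights m → ℚ
score {m} w = foldr _⊔_ 0ℚ (map (pathSumFrom w 0 0) (paths m))

ℕtoℚ : ℕ → ℚ
ℕtoℚ n = Data.Integer.+ n ℚ./ 1
  where import Data.Integer

{-# OPTIONS --safe #-}
-- Fix a path of maximal weight and cut it into its maximal straight runs, numbered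
-- 0, 1, 2, …; every cell of the path except the first is reached by a move of exactly
-- one run.  For a residue r mod Δ, drop the runs whose number is ≡ r: what remains falls
-- apart into blocks of at most Δ − 1 consecutive runs, each of which is a Δ-multisegment.
-- A dropped run is followed by a turn, so consecutive blocks are strictly separated in
-- both coordinates, and the blocks of one residue are pairwise non-conflicting.  Every
-- cell of the path is lost for at most one residue, so the Δ families together cover
-- the path Δ − 1 times, and the best of them is worth at least (Δ − 1)/Δ of the score.
module Submission where

open import Algebra.Bundles using (CommutativeMonoid)
open import Data.Bool using (Bool; true; false; not; T; T?; if_then_else_; _∧_; _∨_)
open import Data.Bool.Properties using (T-∧; T-∨)
open import Data.Empty using (⊥-elim)
open import Data.Fin using (Fin; toℕ; fromℕ<)
open import Data.Fin.Properties using (toℕ-fromℕ<; toℕ≤pred[n])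
open import Data.List using (List; []; _∷_; map; foldr; length; allFin)
open import Data.List.Membership.Propositional using (_∈_)
open import Data.List.Membership.Propositional.Properties
  using (∈-allFin; ∈-map⁺; ∈-map⁻; ∈-concatMap⁺; ∈-filter⁻; foldr-selective)
open import Data.List.Properties using (map-cong)
open import Data.List.Relation.Unary.All as All using (All; []; _∷_)
import Data.List.Relation.Unary.All.Properties as All
open import Data.List.Relation.Unary.AllPairs using (AllPairs; []; _∷_)
open import Data.List.Relation.Unary.Any as Any using (Any; here; there)
open import Data.Nat using (ℕ; zero; suc; _+_; _≤_; _<_; _∸_; _⊓_; z≤n; s≤s)
import Data.Nat as ℕ
import Data.Nat.DivMod as ℕ
import Data.Nat.Properties as ℕ
open import Data.Product using (∃; _×_; _,_; proj₁; proj₂; uncurry; map₁)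
open import Data.Product.Properties using (≡-dec)
open import Data.Rational using (ℚ; 0ℚ; 1ℚ; _*_; mkℚ) renaming (_+_ to _+ℚ_; _≤_ to _≤ℚ_)
import Data.Rational.Properties as ℚ
open import Data.Sum using (_⊎_; inj₁; inj₂)
open import Function using (_∘_)
open import Function.Bundles using (Equivalence)
open import Relation.Binary.Definitions using (DecidableEquality)
open import Relation.Binary.PropositionalEquality
open import Relation.Nullary using (¬_; yes; no; does)
open import Relation.Nullary.Decidable using (dec-true)

open import Defs
open import Algebra.Properties.CommutativeSemigroup
  (CommutativeMonoid.commutativeSemigroup ℚ.+-0-commutativeMonoid) using (interchange)
open import Algebra.Properties.Monoid.Mult ℚ.+-0-monoid using (×-homo-+) renaming (_×_ to _·_)

ℕtoℚ-suc : ∀ n → ℕtoℚ (suc n) ≡ 1ℚ +ℚ ℕtoℚ n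
ℕtoℚ-suc n = begin
  + suc n / 1              ≡⟨ ℚ./-cong (cong (+ 1 +ℤ_) (sym (ℤ.*-identityʳ (+ n)))) refl ⟩
  (+ 1 +ℤ + n *ℤ + 1) / 1  ≡⟨⟩
  1ℚ +ℚ mkℚ (+ n) 0 n⊥1    ≡⟨ cong (1ℚ +ℚ_) (sym (ℚ.normalize-coprime n⊥1)) ⟩
  1ℚ +ℚ ℕtoℚ n             ∎
  where
  open ≡-Reasoning
  open Data.Rational using (_/_)
  open import Data.Nat.Coprimality as Coprime using (1-coprimeTo)
  n⊥1 = Coprime.sym (1-coprimeTo n)
  open import Data.Integer using (+_) renaming (_+_ to _+ℤ_; _*_ to _*ℤ_)
  import Data.Integer.Properties as ℤ

ℕtoℚ*≡· : ∀ n q → ℕtoℚ n * q ≡ n · q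
ℕtoℚ*≡· zero    q = ℚ.*-zeroˡ q
ℕtoℚ*≡· (suc n) q = begin
  ℕtoℚ (suc n) * q         ≡⟨ cong (_* q) (ℕtoℚ-suc n) ⟩
  (1ℚ +ℚ ℕtoℚ n) * q       ≡⟨ ℚ.*-distribʳ-+ q 1ℚ (ℕtoℚ n) ⟩
  1ℚ * q +ℚ ℕtoℚ n * q     ≡⟨ cong₂ _+ℚ_ (ℚ.*-identityˡ q) (ℕtoℚ*≡· n q) ⟩
  q +ℚ n · q               ∎
  where open ≡-Reasoning

·-nonNeg : ∀ n {q} → 0ℚ ≤ℚ q → 0ℚ ≤ℚ n · q
·-nonNeg zero    0≤q = ℚ.≤-refl
·-nonNeg (suc n) 0≤q = ℚ.+-mono-≤ 0≤q (·-nonNeg n 0≤q)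

·-monoˡ-≤ : ∀ {q} → 0ℚ ≤ℚ q → ∀ {a b} → a ≤ b → a · q ≤ℚ b · q
·-monoˡ-≤     0≤q {b = b} z≤n       = ·-nonNeg b 0≤q
·-monoˡ-≤ {q} 0≤q         (s≤s a≤b) = ℚ.+-monoʳ-≤ q (·-monoˡ-≤ 0≤q a≤b)

·-monoʳ-≤ : ∀ n {p q} → p ≤ℚ q → n · p ≤ℚ n · q
·-monoʳ-≤ zero    p≤q = ℚ.≤-refl
·-monoʳ-≤ (suc n) p≤q = ℚ.+-mono-≤ p≤q (·-monoʳ-≤ n p≤q)

module _ {A : Set} where

  sumℚ-zero : ∀ (xs : List A) → sumℚ (map (λ _ → 0ℚ) xs) ≡ 0ℚ
  sumℚ-zero []       = refl
  sumℚ-zero (x ∷ xs) = trans (ℚ.+-identityˡ _) (sumℚ-zero xs)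

  sumℚ-+ : ∀ (f g : A → ℚ) xs →
           sumℚ (map (λ x → f x +ℚ g x) xs) ≡ sumℚ (map f xs) +ℚ sumℚ (map g xs)
  sumℚ-+ f g []       = refl
  sumℚ-+ f g (x ∷ xs) = trans (cong (f x +ℚ g x +ℚ_) (sumℚ-+ f g xs))
    (interchange (f x) (g x) (sumℚ (map f xs)) (sumℚ (map g xs)))

  sumℚ-mono : ∀ {f g : A → ℚ} → (∀ x → f x ≤ℚ g x) → ∀ xs → sumℚ (map f xs) ≤ℚ sumℚ (map g xs)
  sumℚ-mono f≤g []       = ℚ.≤-refl
  sumℚ-mono f≤g (x ∷ xs) = ℚ.+-mono-≤ (f≤g x) (sumℚ-mono f≤g xs)

  sumℚ-nonNeg : ∀ {f : A → ℚ} → (∀ x → 0ℚ ≤ℚ f x) → ∀ xs → 0ℚ ≤ℚ sumℚ (map f xs)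
  sumℚ-nonNeg {f} 0≤f xs =
    subst (_≤ℚ sumℚ (map f xs)) (sumℚ-zero xs) (sumℚ-mono {f = λ _ → 0ℚ} 0≤f xs)

  ∈⇒≤sumℚ : ∀ {f : A → ℚ} → (∀ x → 0ℚ ≤ℚ f x) → ∀ {x xs} → x ∈ xs → f x ≤ℚ sumℚ (map f xs)
  ∈⇒≤sumℚ {f} 0≤f {x} {_ ∷ xs} (here refl) =
    subst (_≤ℚ sumℚ (map f (x ∷ xs))) (ℚ.+-identityʳ (f x))
          (ℚ.+-monoʳ-≤ (f x) (sumℚ-nonNeg 0≤f xs))
  ∈⇒≤sumℚ {f} 0≤f {x} {y ∷ xs} (there x∈xs) =
    subst (_≤ℚ sumℚ (map f (y ∷ xs))) (ℚ.+-identityˡ (f x))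
          (ℚ.+-mono-≤ (0≤f y) (∈⇒≤sumℚ 0≤f x∈xs))

∑ℕ : ℕ → (ℕ → ℕ) → ℕ
∑ℕ zero    f = 0
∑ℕ (suc n) f = f n + ∑ℕ n f

∑ℚ : ℕ → (ℕ → ℚ) → ℚ
∑ℚ zero    f = 0ℚ
∑ℚ (suc n) f = f n +ℚ ∑ℚ n f

∑ℕ-const : ∀ n v → ∑ℕ n (λ _ → v) ≡ n ℕ.* v
∑ℕ-const zero    v = refl
∑ℕ-const (suc n) v = cong (v +_) (∑ℕ-const n v)

∑ℚ-const : ∀ n q → ∑ℚ n (λ _ → q) ≡ n · q
∑ℚ-const zero    q = refl
∑ℚ-const (suc n) q = cong (q +ℚ_) (∑ℚ-const n q)

∑ℚ-cong : ∀ n {f g : ℕ → ℚ} → (∀ r → f r ≡ g r) → ∑ℚ n f ≡ ∑ℚ n g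
∑ℚ-cong zero    f≡g = refl
∑ℚ-cong (suc n) f≡g = cong₂ _+ℚ_ (f≡g n) (∑ℚ-cong n f≡g)

∑ℚ≤·max : ∀ n (f : ℕ → ℚ) → ∃ λ r → r < suc n × ∑ℚ (suc n) f ≤ℚ suc n · f r
∑ℚ≤·max zero    f = 0 , s≤s z≤n , ℚ.≤-refl
∑ℚ≤·max (suc n) f with ∑ℚ≤·max n f | ℚ.≤-total (f (proj₁ (∑ℚ≤·max n f))) (f (suc n))
... | r , r<1+n , ∑≤ | inj₁ fr≤fn = suc n , ℕ.≤-refl ,
  ℚ.+-monoʳ-≤ (f (suc n)) (ℚ.≤-trans ∑≤ (·-monoʳ-≤ (suc n) fr≤fn))
... | r , r<1+n , ∑≤ | inj₂ fn≤fr = r , ℕ.m≤n⇒m≤1+n r<1+n , ℚ.+-mono-≤ fn≤fr ∑≤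

n≤∑ℕ : ∀ n (f : ℕ → ℕ) → (∀ r → r < n → 1 ≤ f r) → n ≤ ∑ℕ n f
n≤∑ℕ zero    f pos = z≤n
n≤∑ℕ (suc n) f pos =
  ℕ.+-mono-≤ (pos n ℕ.≤-refl) (n≤∑ℕ n f (λ r r<n → pos r (ℕ.m≤n⇒m≤1+n r<n)))

n∸1≤∑ℕ : ∀ n (f : ℕ → ℕ) r₀ → (∀ r → r < n → r ≢ r₀ → 1 ≤ f r) → n ∸ 1 ≤ ∑ℕ n f
n∸1≤∑ℕ zero    f r₀ pos = z≤n
n∸1≤∑ℕ (suc n) f r₀ pos with n ℕ.≟ r₀
... | yes refl = ℕ.≤-trans (n≤∑ℕ n f (λ r r<n → pos r (ℕ.m≤n⇒m≤1+n r<n) (ℕ.<⇒≢ r<n)))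
                           (ℕ.m≤n+m (∑ℕ n f) (f n))
... | no n≢r₀  = ℕ.≤-trans (ℕ.m≤n+m∸n n 1) (ℕ.+-mono-≤ (pos n ℕ.≤-refl n≢r₀)
                   (n∸1≤∑ℕ n f r₀ (λ r r<n → pos r (ℕ.m≤n⇒m≤1+n r<n))))

-- Monotone lattice paths

Point : Set
Point = ℕ × ℕ

_≤ₚ_ : Point → Point → Set
(x , y) ≤ₚ (x′ , y′) = x ≤ x′ × y ≤ y′

_<ₚ_ : Point → Point → Set
(x , y) <ₚ (x′ , y′) = x < x′ × y < y′

≤ₚ-refl : ∀ {p} → p ≤ₚ p
≤ₚ-refl = ℕ.≤-refl , ℕ.≤-refl

≤ₚ-trans : ∀ {p q r} → p ≤ₚ q → q ≤ₚ r → p ≤ₚ r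
≤ₚ-trans (x≤ , y≤) (x≤′ , y≤′) = ℕ.≤-trans x≤ x≤′ , ℕ.≤-trans y≤ y≤′

<ₚ-≤ₚ-trans : ∀ {p q r} → p <ₚ q → q ≤ₚ r → p <ₚ r
<ₚ-≤ₚ-trans (x< , y<) (x≤ , y≤) = ℕ.<-≤-trans x< x≤ , ℕ.<-≤-trans y< y≤

≤ₚ-<ₚ-trans : ∀ {p q r} → p ≤ₚ q → q <ₚ r → p <ₚ r
≤ₚ-<ₚ-trans (x≤ , y≤) (x< , y<) = ℕ.≤-<-trans x≤ x< , ℕ.≤-<-trans y≤ y<

_≟ₚ_ : DecidableEquality Point
_≟ₚ_ = ≡-dec ℕ._≟_ ℕ._≟_

step : Bool → Point → Point
step true  (x , y) = suc x , y
step false (x , y) = x , suc y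

steps : Bool → ℕ → Point → Point
steps d zero    p = p
steps d (suc n) p = steps d n (step d p)

p≤ₚstep : ∀ d p → p ≤ₚ step d p
p≤ₚstep true  p = ℕ.n≤1+n _ , ℕ.≤-refl
p≤ₚstep false p = ℕ.≤-refl , ℕ.n≤1+n _

step≰ₚp : ∀ d p → ¬ (step d p ≤ₚ p)
step≰ₚp true  p (1+x≤x , _) = ℕ.1+n≰n 1+x≤x
step≰ₚp false p (_ , 1+y≤y) = ℕ.1+n≰n 1+y≤y

steps-mono : ∀ d {i n} → i ≤ n → ∀ p → steps d i p ≤ₚ steps d n p
steps-mono d {n = zero}  z≤n       p = ≤ₚ-refl
steps-mono d {n = suc n} z≤n       p = ≤ₚ-trans (p≤ₚstep d p) (steps-mono d {n = n} z≤n (step d p))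
steps-mono d             (s≤s i≤n) p = steps-mono d i≤n (step d p)

p≤ₚsteps : ∀ d n p → p ≤ₚ steps d n p
p≤ₚsteps d n = steps-mono d {0} {n} z≤n

<ₚ-turn : ∀ d n p → p <ₚ step (not d) (steps d (suc n) p)
<ₚ-turn true  n p = let x< , y≤ = p≤ₚsteps true n (step true p) in x< , s≤s y≤
<ₚ-turn false n p = let x≤ , y< = p≤ₚsteps false n (step false p) in s≤s x≤ , y<

proj₂-steps-true : ∀ n p → proj₂ (steps true n p) ≡ proj₂ p
proj₂-steps-true zero    p = refl
proj₂-steps-true (suc n) p = proj₂-steps-true n (step true p)

proj₁-steps-false : ∀ n p → proj₁ (steps false n p) ≡ proj₁ p
proj₁-steps-false zero    p = refl
proj₁-steps-false (suc n) p = proj₁-steps-false n (step false p)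

δ : Point → Point → ℕ
δ p q = if does (p ≟ₚ q) then 1 else 0

visits : Point → List Bool → Point → ℕ
visits p []      q = δ p q
visits p (b ∷ u) q = δ p q + visits (step b p) u q

visited⇒≤ₚ : ∀ p u q → 1 ≤ visits p u q → p ≤ₚ q
visited⇒≤ₚ p []      q h with p ≟ₚ q
... | yes refl = ≤ₚ-refl
visited⇒≤ₚ p (b ∷ u) q h with p ≟ₚ q
... | yes refl = ≤ₚ-refl
... | no _     = ≤ₚ-trans (p≤ₚstep b p) (visited⇒≤ₚ (step b p) u q h)

visits-after-step≡0 : ∀ b p u → visits (step b p) u p ≡ 0
visits-after-step≡0 b p u with visits (step b p) u p in eq
... | zero  = refl
... | suc _ = ⊥-elim (step≰ₚp b p (visited⇒≤ₚ (step b p) u p (subst (1 ≤_) (sym eq) (s≤s z≤n))))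

visits≤1 : ∀ p u q → visits p u q ≤ 1
visits≤1 p []      q with p ≟ₚ q
... | yes _ = ℕ.≤-refl
... | no _  = z≤n
visits≤1 p (b ∷ u) q with p ≟ₚ q
... | yes refl = ℕ.≤-reflexive (cong suc (visits-after-step≡0 b p u))
... | no _     = visits≤1 (step b p) u q

-- Maximal straight runs

-- (d , n₀ ∷ n₁ ∷ …) stands for a run of 1 + n₀ moves in direction d, then a run of
-- 1 + n₁ moves in direction not d, and so on: the maximal straight runs of a path.
Zigzag : Set
Zigzag = Bool × List ℕ

prepend : Bool → Zigzag → Zigzag
prepend b     (_     , [])     = b , 0 ∷ []
prepend true  (true  , n ∷ ns) = true , suc n ∷ ns
prepend false (false , n ∷ ns) = false , suc n ∷ ns
prepend true  (false , n ∷ ns) = true , 0 ∷ n ∷ ns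
prepend false (true  , n ∷ ns) = false , 0 ∷ n ∷ ns

zigzag : List Bool → Zigzag
zigzag []      = true , []
zigzag (b ∷ u) = prepend b (zigzag u)

zigzagEnd : Point → Bool → List ℕ → Point
zigzagEnd p d []       = p
zigzagEnd p d (n ∷ ns) = zigzagEnd (steps d (suc n) p) (not d) ns

data InRun (q : Point) : Point → Bool → List ℕ → ℕ → Set where
  first-run : ∀ {p d n ns i} → i ≤ n → q ≡ steps d (suc i) p → InRun q p d (n ∷ ns) 0
  later-run : ∀ {p d n ns j} → InRun q (steps d (suc n) p) (not d) ns j → InRun q p d (n ∷ ns) (suc j)

p≤ₚzigzagEnd : ∀ p d ns → p ≤ₚ zigzagEnd p d ns
p≤ₚzigzagEnd p d []       = ≤ₚ-refl
p≤ₚzigzagEnd p d (n ∷ ns) = ≤ₚ-trans (p≤ₚsteps d (suc n) p) (p≤ₚzigzagEnd _ (not d) ns)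

zigzagEnd-prepend : ∀ b p z → uncurry (zigzagEnd p) (prepend b z) ≡ uncurry (zigzagEnd (step b p)) z
zigzagEnd-prepend b     p (_     , [])     = refl
zigzagEnd-prepend true  p (true  , n ∷ ns) = refl
zigzagEnd-prepend false p (false , n ∷ ns) = refl
zigzagEnd-prepend true  p (false , n ∷ ns) = refl
zigzagEnd-prepend false p (true  , n ∷ ns) = refl

InRun-prepend : ∀ b p z {q j} → InRun q (step b p) (proj₁ z) (proj₂ z) j →
                ∃ (uncurry (InRun q p) (prepend b z))
InRun-prepend true  p (true  , n ∷ ns) (first-run i≤n q≡) = 0 , first-run (s≤s i≤n) q≡
InRun-prepend false p (false , n ∷ ns) (first-run i≤n q≡) = 0 , first-run (s≤s i≤n) q≡
InRun-prepend true  p (true  , n ∷ ns) (later-run x)      = _ , later-run x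
InRun-prepend false p (false , n ∷ ns) (later-run x)      = _ , later-run x
InRun-prepend true  p (false , n ∷ ns) x                  = _ , later-run x
InRun-prepend false p (true  , n ∷ ns) x                  = _ , later-run x

InRun-prepend-first : ∀ b p z {q} → q ≡ step b p → uncurry (InRun q p) (prepend b z) 0
InRun-prepend-first b     p (_     , [])     q≡ = first-run z≤n q≡
InRun-prepend-first true  p (true  , n ∷ ns) q≡ = first-run z≤n q≡
InRun-prepend-first false p (false , n ∷ ns) q≡ = first-run z≤n q≡
InRun-prepend-first true  p (false , n ∷ ns) q≡ = first-run z≤n q≡
InRun-prepend-first false p (true  , n ∷ ns) q≡ = first-run z≤n q≡

visited⇒InRun : ∀ p u q → 1 ≤ visits p u q → q ≡ p ⊎ ∃ (uncurry (InRun q p) (zigzag u))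
visited⇒InRun p []      q h with p ≟ₚ q
... | yes refl = inj₁ refl
visited⇒InRun p (b ∷ u) q h with p ≟ₚ q
... | yes refl = inj₁ refl
... | no _ with visited⇒InRun (step b p) u q h
...   | inj₁ q≡    = inj₂ (0 , InRun-prepend-first b p (zigzag u) q≡)
...   | inj₂ (_ , x) = inj₂ (InRun-prepend b p (zigzag u) x)

countUp : List Bool → ℕ
countUp []          = 0
countUp (true  ∷ u) = countUp u
countUp (false ∷ u) = suc (countUp u)

countRight+countUp : ∀ u → countRight u + countUp u ≡ length u
countRight+countUp []          = refl
countRight+countUp (true  ∷ u) = cong suc (countRight+countUp u)
countRight+countUp (false ∷ u) = trans (ℕ.+-suc (countRight u) (countUp u)) (cong suc (countRight+countUp u))

zigzagEnd-zigzag : ∀ u x y → uncurry (zigzagEnd (x , y)) (zigzag u) ≡ (countRight u + x , countUp u + y)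
zigzagEnd-zigzag []          x y = refl
zigzagEnd-zigzag (true  ∷ u) x y = begin
  uncurry (zigzagEnd (x , y)) (prepend true (zigzag u)) ≡⟨ zigzagEnd-prepend true (x , y) (zigzag u) ⟩
  uncurry (zigzagEnd (suc x , y)) (zigzag u)            ≡⟨ zigzagEnd-zigzag u (suc x) y ⟩
  (countRight u + suc x , countUp u + y)                 ≡⟨ cong (_, countUp u + y) (ℕ.+-suc (countRight u) x) ⟩
  (suc (countRight u + x) , countUp u + y)               ∎
  where open ≡-Reasoning
zigzagEnd-zigzag (false ∷ u) x y = begin
  uncurry (zigzagEnd (x , y)) (prepend false (zigzag u)) ≡⟨ zigzagEnd-prepend false (x , y) (zigzag u) ⟩
  uncurry (zigzagEnd (x , suc y)) (zigzag u)             ≡⟨ zigzagEnd-zigzag u x (suc y) ⟩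
  (countRight u + x , countUp u + suc y)                 ≡⟨ cong (countRight u + x ,_) (ℕ.+-suc (countUp u) y) ⟩
  (countRight u + x , suc (countUp u + y))               ∎
  where open ≡-Reasoning

-- Pieces of a path, and the Δ families of pieces

Run : Set
Run = Bool × ℕ

infix 4 _▹_

record Piece : Set where
  constructor _▹_
  field
    start : Point
    runs  : List Run
open Piece

runsEnd : Point → List Run → Point
runsEnd p []             = p
runsEnd p ((d , n) ∷ rs) = runsEnd (steps d n p) rs

end : Piece → Point
end (p ▹ rs) = runsEnd p rs

Before : Piece → Piece → Set
Before P Q = end P <ₚ start Q

data InPiece (q : Point) : Piece → Set where
  at-start : ∀ {p rs} → q ≡ p → InPiece q (p ▹ rs)
  on-first : ∀ {p d n rs i} → i ≤ n → q ≡ steps d i p → InPiece q (p ▹ (d , n) ∷ rs)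
  further  : ∀ {p d n rs} → InPiece q (steps d n p ▹ rs) → InPiece q (p ▹ (d , n) ∷ rs)

sorted-extend : ∀ {p d n rs Ps} → AllPairs Before ((steps d n p ▹ rs) ∷ Ps) →
                AllPairs Before ((p ▹ (d , n) ∷ rs) ∷ Ps)
sorted-extend (before ∷ sorted) = before ∷ sorted

covered-extend : ∀ {q p d n rs Ps} → Any (InPiece q) ((steps d n p ▹ rs) ∷ Ps) →
                 Any (InPiece q) ((p ▹ (d , n) ∷ rs) ∷ Ps)
covered-extend (here q∈P) = here (further q∈P)
covered-extend (there q∈Ps) = there q∈Ps

module Families (D : ℕ) where

  Δ : ℕ
  Δ = 2 + D

  -- On the runs (d , ns) of a path from p, cut k returns the runs of the piece under
  -- construction and the later pieces: the current piece takes k more runs, then one run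
  -- is dropped, and the next piece starts one move into the following run and takes
  -- D + 1 runs (the first of them shortened by that move).  Writing not (not d) for d
  -- keeps cut definitionally in step with zigzagEnd and InRun.
  cut : ℕ → Point → Bool → List ℕ → List Run × List Piece
  cut k       p d []            = [] , []
  cut (suc k) p d (n ∷ ns)      = map₁ ((d , suc n) ∷_) (cut k (steps d (suc n) p) (not d) ns)
  cut zero    p d (n ∷ [])      = [] , []
  cut zero    p d (n ∷ n′ ∷ ns) = [] , (p′ ▹ (not d , n′) ∷ proj₁ rest) ∷ proj₂ rest
    where
    p′ = step (not d) (steps d (suc n) p)
    rest = cut D (steps (not d) n′ p′) (not (not d)) ns

  family : ℕ → Point → Bool → List ℕ → List Piece
  family k p d ns = (p ▹ proj₁ (cut k p d ns)) ∷ proj₂ (cut k p d ns)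

  cut-length : ∀ k p d ns → length (proj₁ (cut k p d ns)) ≤ k
  cut-length k       p d []            = z≤n
  cut-length (suc k) p d (n ∷ ns)      = s≤s (cut-length k _ (not d) ns)
  cut-length zero    p d (n ∷ [])      = z≤n
  cut-length zero    p d (n ∷ n′ ∷ ns) = z≤n

  cut-pieces-length : ∀ k p d ns → All (λ P → length (runs P) ≤ suc D) (proj₂ (cut k p d ns))
  cut-pieces-length k       p d []            = []
  cut-pieces-length (suc k) p d (n ∷ ns)      = cut-pieces-length k _ (not d) ns
  cut-pieces-length zero    p d (n ∷ [])      = []
  cut-pieces-length zero    p d (n ∷ n′ ∷ ns) = s≤s (cut-length D _ _ ns) ∷ cut-pieces-length D _ _ ns

  family-length : ∀ {k} → k ≤ suc D → ∀ p d ns → All (λ P → length (runs P) ≤ suc D) (family k p d ns)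
  family-length {k} k≤ p d ns = ℕ.≤-trans (cut-length k p d ns) k≤ ∷ cut-pieces-length k p d ns

  family-starts-≥ : ∀ k p d ns → All (λ P → p ≤ₚ start P) (family k p d ns)
  family-starts-≥ k       p d []            = ≤ₚ-refl ∷ []
  family-starts-≥ (suc k) p d (n ∷ ns)      =
    ≤ₚ-refl ∷ All.map (≤ₚ-trans (p≤ₚsteps d (suc n) p)) (All.tail (family-starts-≥ k _ (not d) ns))
  family-starts-≥ zero    p d (n ∷ [])      = ≤ₚ-refl ∷ []
  family-starts-≥ zero    p d (n ∷ n′ ∷ ns) =
    ≤ₚ-refl ∷ p≤p′
            ∷ All.map (≤ₚ-trans (≤ₚ-trans p≤p′ (p≤ₚsteps (not d) n′ p′)))
                      (All.tail (family-starts-≥ D _ _ ns))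
    where
    p′ = step (not d) (steps d (suc n) p)
    p≤p′ : p ≤ₚ p′
    p≤p′ = ≤ₚ-trans (p≤ₚsteps d (suc n) p) (p≤ₚstep (not d) _)

  family-starts-≤end : ∀ k p d ns → All (λ P → start P ≤ₚ zigzagEnd p d ns) (family k p d ns)
  family-starts-≤end k       p d []            = ≤ₚ-refl ∷ []
  family-starts-≤end (suc k) p d (n ∷ ns)      =
    p≤ₚzigzagEnd p d (n ∷ ns) ∷ All.tail (family-starts-≤end k _ (not d) ns)
  family-starts-≤end zero    p d (n ∷ [])      = p≤ₚzigzagEnd p d (n ∷ []) ∷ []
  family-starts-≤end zero    p d (n ∷ n′ ∷ ns) =
    p≤ₚzigzagEnd p d (n ∷ n′ ∷ ns)
    ∷ ≤ₚ-trans (p≤ₚsteps (not d) n′ p′) (p≤ₚzigzagEnd _ (not (not d)) ns)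
    ∷ All.tail (family-starts-≤end D _ _ ns)
    where p′ = step (not d) (steps d (suc n) p)

  family-sorted : ∀ k p d ns → AllPairs Before (family k p d ns)
  family-sorted k       p d []            = [] ∷ []
  family-sorted (suc k) p d (n ∷ ns)      = sorted-extend (family-sorted k _ (not d) ns)
  family-sorted zero    p d (n ∷ [])      = [] ∷ []
  family-sorted zero    p d (n ∷ n′ ∷ ns) =
    (<ₚ-turn d n p ∷ All.map (<ₚ-≤ₚ-trans p<X) (All.tail (family-starts-≥ D _ _ ns)))
    ∷ sorted-extend (family-sorted D _ _ ns)
    where
    p<X : p <ₚ steps (not d) n′ (step (not d) (steps d (suc n) p))
    p<X = <ₚ-≤ₚ-trans (<ₚ-turn d n p) (p≤ₚsteps (not d) n′ _)

  family-covers : ∀ k p d ns {q j} → InRun q p d ns j → (∀ t → j ≢ k + t ℕ.* Δ) →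
                  Any (InPiece q) (family k p d ns)
  family-covers (suc k) p d (n ∷ ns) (first-run i≤n q≡) kept = here (on-first (s≤s i≤n) q≡)
  family-covers (suc k) p d (n ∷ ns) (later-run x)      kept =
    covered-extend (family-covers k _ (not d) ns x (λ t → kept t ∘ cong suc))
  family-covers zero p d (n ∷ ns) (first-run _ _) kept = ⊥-elim (kept 0 refl)
  family-covers zero p d (n ∷ n′ ∷ ns) (later-run (first-run i≤n′ q≡)) kept =
    there (here (on-first i≤n′ q≡))
  family-covers zero p d (n ∷ n′ ∷ ns) (later-run (later-run x)) kept =
    there (covered-extend (family-covers D _ _ ns x (λ t → kept (suc t) ∘ cong (suc ∘ suc))))

T-∧³⁻ : ∀ x y z → T (x ∧ (y ∧ z)) → T x × T y × T z
T-∧³⁻ x y z t = let tx , tyz = Equivalence.to (T-∧ {x}) t in tx , Equivalence.to (T-∧ {y}) tyz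

T-∧³⁺ : ∀ {x y z} → T x → T y → T z → T (x ∧ (y ∧ z))
T-∧³⁺ {x} {y} tx ty tz = Equivalence.from (T-∧ {x}) (tx , Equivalence.from (T-∧ {y}) (ty , tz))

⌊_⌋ : ∀ {m} → Cell m → Point
⌊ c ⌋ = col c , row c

inSeg⇒between : ∀ {m} {c : Cell m} s → InSeg c s → ⌊ first s ⌋ ≤ₚ ⌊ c ⌋ × ⌊ c ⌋ ≤ₚ ⌊ last s ⌋
inSeg⇒between {c = c} (hor y a b _) c∈s =
  let row≡y , a≤col , col≤b = T-∧³⁻ (row c ℕ.≡ᵇ toℕ y) (toℕ a ℕ.≤ᵇ col c) (col c ℕ.≤ᵇ toℕ b) c∈s
      row≡ = ℕ.≡ᵇ⇒≡ (row c) (toℕ y) row≡y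
  in (ℕ.≤ᵇ⇒≤ _ _ a≤col , ℕ.≤-reflexive (sym row≡)) , (ℕ.≤ᵇ⇒≤ _ _ col≤b , ℕ.≤-reflexive row≡)
inSeg⇒between {c = c} (ver x a b _) c∈s =
  let col≡x , a≤row , row≤b = T-∧³⁻ (col c ℕ.≡ᵇ toℕ x) (toℕ a ℕ.≤ᵇ row c) (row c ℕ.≤ᵇ toℕ b) c∈s
      col≡ = ℕ.≡ᵇ⇒≡ (col c) (toℕ x) col≡x
  in (ℕ.≤-reflexive (sym col≡) , ℕ.≤ᵇ⇒≤ _ _ a≤row) , (ℕ.≤-reflexive col≡ , ℕ.≤ᵇ⇒≤ _ _ row≤b)

between⇒inSeg : ∀ {m} {c : Cell m} s → ⌊ first s ⌋ ≤ₚ ⌊ c ⌋ × ⌊ c ⌋ ≤ₚ ⌊ last s ⌋ → InSeg c s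
between⇒inSeg {c = c} (hor y a b _) ((a≤col , y≤row) , (col≤b , row≤y)) =
  T-∧³⁺ (ℕ.≡⇒≡ᵇ (row c) (toℕ y) (ℕ.≤-antisym row≤y y≤row)) (ℕ.≤⇒≤ᵇ a≤col) (ℕ.≤⇒≤ᵇ col≤b)
between⇒inSeg {c = c} (ver x a b _) ((x≤col , a≤row) , (col≤x , row≤b)) =
  T-∧³⁺ (ℕ.≡⇒≡ᵇ (col c) (toℕ x) (ℕ.≤-antisym col≤x x≤col)) (ℕ.≤⇒≤ᵇ a≤row) (ℕ.≤⇒≤ᵇ row≤b)

inSeg⇒covers : ∀ {m Δ} (S : Multiseg m Δ) {c} i → InSeg c (seg S i) → T (coversᵇ S c)
inSeg⇒covers {Δ = Δ} S {c} i c∈Sᵢ = covered-along (allFin Δ) (∈-allFin i)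
  where
  covered-along : ∀ is → i ∈ is → T (foldr (λ j acc → inSegᵇ c (seg S j) ∨ acc) false is)
  covered-along (j ∷ is) (here refl) = Equivalence.from T-∨ (inj₁ c∈Sᵢ)
  covered-along (j ∷ is) (there i∈is) =
    Equivalence.from (T-∨ {inSegᵇ c (seg S j)}) (inj₂ (covered-along is i∈is))

coverCount : ∀ {m Δ} → List (Multiseg m Δ) → Cell m → ℕ
coverCount []       c = 0
coverCount (S ∷ Ss) c = (if coversᵇ S c then 1 else 0) + coverCount Ss c

covers⇒1≤coverCount : ∀ {m Δ} S Ss {c : Cell m} → T (coversᵇ {Δ = Δ} S c) → 1 ≤ coverCount (S ∷ Ss) c
covers⇒1≤coverCount S Ss {c} S-covers with coversᵇ S c
... | true = s≤s z≤n

module Table (m′ : ℕ) where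

  -- Points are clamped into the table; every point that matters lies in it already.
  clamp : ℕ → Fin (suc m′)
  clamp n = fromℕ< (s≤s (ℕ.m⊓n≤n n m′))

  toℕ-clamp : ∀ n → toℕ (clamp n) ≡ n ⊓ m′
  toℕ-clamp n = toℕ-fromℕ< (s≤s (ℕ.m⊓n≤n n m′))

  clamp≤ : ∀ n → toℕ (clamp n) ≤ n
  clamp≤ n = subst (_≤ n) (sym (toℕ-clamp n)) (ℕ.m⊓n≤m n m′)

  clamp-mono : ∀ {a b} → a ≤ b → toℕ (clamp a) ≤ toℕ (clamp b)
  clamp-mono {a} {b} a≤b = subst₂ _≤_ (sym (toℕ-clamp a)) (sym (toℕ-clamp b)) (ℕ.⊓-monoˡ-≤ m′ a≤b)

  clamp-inside : ∀ {n} → n ≤ m′ → toℕ (clamp n) ≡ n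
  clamp-inside {n} n≤m′ = trans (toℕ-clamp n) (ℕ.m≤n⇒m⊓n≡m n≤m′)

  clampₚ : Point → Cell (suc m′)
  clampₚ (x , y) = clamp x , clamp y

  ⌊clampₚ⌋≤ₚ : ∀ p → ⌊ clampₚ p ⌋ ≤ₚ p
  ⌊clampₚ⌋≤ₚ (x , y) = clamp≤ x , clamp≤ y

  ⌊clampₚ⌋-mono : ∀ {p q} → p ≤ₚ q → ⌊ clampₚ p ⌋ ≤ₚ ⌊ clampₚ q ⌋
  ⌊clampₚ⌋-mono (x≤ , y≤) = clamp-mono x≤ , clamp-mono y≤

  ⌊clampₚ⌋-inside : ∀ {p} → p ≤ₚ (m′ , m′) → ⌊ clampₚ p ⌋ ≡ p
  ⌊clampₚ⌋-inside (x≤ , y≤) = cong₂ _,_ (clamp-inside x≤) (clamp-inside y≤)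

  ⌊clampₚ⌊c⌋⌋ : ∀ (c : Cell (suc m′)) → ⌊ clampₚ ⌊ c ⌋ ⌋ ≡ ⌊ c ⌋
  ⌊clampₚ⌊c⌋⌋ c = ⌊clampₚ⌋-inside (toℕ≤pred[n] (proj₁ c) , toℕ≤pred[n] (proj₂ c))

  segment : Point → Run → Segment (suc m′)
  segment p (true  , n) = hor (clamp (proj₂ p)) (clamp (proj₁ p)) (clamp (proj₁ (steps true n p)))
                              (clamp-mono (proj₁ (p≤ₚsteps true n p)))
  segment p (false , n) = ver (clamp (proj₁ p)) (clamp (proj₂ p)) (clamp (proj₂ (steps false n p)))
                              (clamp-mono (proj₂ (p≤ₚsteps false n p)))

  first-segment : ∀ p d n → first (segment p (d , n)) ≡ clampₚ p
  first-segment p true  n = refl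
  first-segment p false n = refl

  last-segment : ∀ p d n → last (segment p (d , n)) ≡ clampₚ (steps d n p)
  last-segment p true  n = cong (λ y → clamp (proj₁ (steps true n p)) , clamp y) (sym (proj₂-steps-true n p))
  last-segment p false n = cong (λ x → clamp x , clamp (proj₂ (steps false n p))) (sym (proj₁-steps-false n p))

  segment-bounds : ∀ p d n {c} → InSeg c (segment p (d , n)) →
                   ⌊ clampₚ p ⌋ ≤ₚ ⌊ c ⌋ × ⌊ c ⌋ ≤ₚ ⌊ clampₚ (steps d n p) ⌋
  segment-bounds p d n {c} c∈s =
    subst₂ (λ a b → ⌊ a ⌋ ≤ₚ ⌊ c ⌋ × ⌊ c ⌋ ≤ₚ ⌊ b ⌋) (first-segment p d n) (last-segment p d n)
           (inSeg⇒between (segment p (d , n)) c∈s)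

  onRun⇒inSeg : ∀ p d {i n} → i ≤ n → ∀ c → ⌊ c ⌋ ≡ steps d i p → InSeg c (segment p (d , n))
  onRun⇒inSeg p d {i} {n} i≤n c c≡ = between⇒inSeg (segment p (d , n))
    (subst₂ (λ a b → ⌊ a ⌋ ≤ₚ ⌊ c ⌋ × ⌊ c ⌋ ≤ₚ ⌊ b ⌋) (sym (first-segment p d n)) (sym (last-segment p d n))
            (lower , upper))
    where
    lower : ⌊ clampₚ p ⌋ ≤ₚ ⌊ c ⌋
    lower = subst (⌊ clampₚ p ⌋ ≤ₚ_) (sym c≡) (≤ₚ-trans (⌊clampₚ⌋≤ₚ p) (p≤ₚsteps d i p))
    upper : ⌊ c ⌋ ≤ₚ ⌊ clampₚ (steps d n p) ⌋
    upper = subst (_≤ₚ ⌊ clampₚ (steps d n p) ⌋) (trans (cong (⌊_⌋ ∘ clampₚ) (sym c≡)) (⌊clampₚ⌊c⌋⌋ c))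
                  (⌊clampₚ⌋-mono (steps-mono d i≤n p))

  -- Past its last run a piece is padded with one-cell segments at its end.
  runAt : List Run → ℕ → Run
  runAt []       k       = true , 0
  runAt (r ∷ rs) zero    = r
  runAt (r ∷ rs) (suc k) = runAt rs k

  corner : Point → List Run → ℕ → Point
  corner p rs             zero    = p
  corner p []             (suc k) = p
  corner p ((d , n) ∷ rs) (suc k) = corner (steps d n p) rs k

  corner-suc : ∀ p rs k → corner p rs (suc k) ≡ uncurry steps (runAt rs k) (corner p rs k)
  corner-suc p []             zero    = refl
  corner-suc p []             (suc k) = refl
  corner-suc p ((d , n) ∷ rs) zero    = refl
  corner-suc p ((d , n) ∷ rs) (suc k) = corner-suc (steps d n p) rs k

  p≤ₚcorner : ∀ p rs k → p ≤ₚ corner p rs k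
  p≤ₚcorner p rs             zero    = ≤ₚ-refl
  p≤ₚcorner p []             (suc k) = ≤ₚ-refl
  p≤ₚcorner p ((d , n) ∷ rs) (suc k) = ≤ₚ-trans (p≤ₚsteps d n p) (p≤ₚcorner _ rs k)

  corner≤ₚrunsEnd : ∀ p rs k → corner p rs k ≤ₚ runsEnd p rs
  corner≤ₚrunsEnd p []             zero    = ≤ₚ-refl
  corner≤ₚrunsEnd p []             (suc k) = ≤ₚ-refl
  corner≤ₚrunsEnd p ((d , n) ∷ rs) zero    = ≤ₚ-trans (p≤ₚsteps d n p) (corner≤ₚrunsEnd _ rs 0)
  corner≤ₚrunsEnd p ((d , n) ∷ rs) (suc k) = corner≤ₚrunsEnd _ rs k

  segmentAt : Point → List Run → ℕ → Segment (suc m′)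
  segmentAt p rs k = segment (corner p rs k) (runAt rs k)

  multiseg : ∀ {Δ} → Piece → Multiseg (suc m′) Δ
  multiseg (p ▹ rs) = mseg (λ i → segmentAt p rs (toℕ i)) consecutive
    where
    consecutive : ∀ i j → toℕ j ≡ suc (toℕ i) →
                  last (segmentAt p rs (toℕ i)) ≡ first (segmentAt p rs (toℕ j))
    consecutive i j j≡1+i = begin
      last (segmentAt p rs k)                            ≡⟨ last-segment (corner p rs k) _ _ ⟩
      clampₚ (uncurry steps (runAt rs k) (corner p rs k)) ≡⟨ cong clampₚ (sym (corner-suc p rs k)) ⟩
      clampₚ (corner p rs (suc k))                       ≡⟨ cong (clampₚ ∘ corner p rs) (sym j≡1+i) ⟩
      clampₚ (corner p rs (toℕ j))                       ≡⟨ sym (first-segment _ _ _) ⟩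
      first (segmentAt p rs (toℕ j))                     ∎
      where
      open ≡-Reasoning
      k = toℕ i

  inPiece⇒onSegment : ∀ {q p rs} → InPiece q (p ▹ rs) →
    ∃ λ k → k ≤ length rs × ∃ λ i → i ≤ proj₂ (runAt rs k) × q ≡ steps (proj₁ (runAt rs k)) i (corner p rs k)
  inPiece⇒onSegment (at-start q≡)      = 0 , z≤n , 0 , z≤n , q≡
  inPiece⇒onSegment (on-first i≤n q≡)  = 0 , z≤n , _ , i≤n , q≡
  inPiece⇒onSegment (further q∈)       =
    let k , k≤ , i , i≤ , q≡ = inPiece⇒onSegment q∈ in suc k , s≤s k≤ , i , i≤ , q≡

  inPiece⇒covers : ∀ {Δ} P → length (runs P) < Δ → ∀ c → InPiece ⌊ c ⌋ P →
                   T (coversᵇ (multiseg {Δ} P) c)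
  inPiece⇒covers {Δ} (p ▹ rs) short c c∈P =
    let k , k≤ , i , i≤ , c≡ = inPiece⇒onSegment c∈P
        k<Δ = ℕ.≤-<-trans k≤ short
    in inSeg⇒covers (multiseg (p ▹ rs)) (fromℕ< k<Δ)
         (subst (λ k → InSeg c (segmentAt p rs k)) (sym (toℕ-fromℕ< k<Δ))
                (onRun⇒inSeg (corner p rs k) (proj₁ (runAt rs k)) i≤ c c≡))

  segmentAt-bounds : ∀ p rs k {c} → InSeg c (segmentAt p rs k) →
                     ⌊ clampₚ p ⌋ ≤ₚ ⌊ c ⌋ × ⌊ c ⌋ ≤ₚ runsEnd p rs
  segmentAt-bounds p rs k c∈s =
    let lower , upper = segment-bounds (corner p rs k) (proj₁ (runAt rs k)) (proj₂ (runAt rs k)) c∈s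
    in ≤ₚ-trans (⌊clampₚ⌋-mono (p≤ₚcorner p rs k)) lower
     , ≤ₚ-trans upper (≤ₚ-trans (⌊clampₚ⌋≤ₚ _)
         (subst (_≤ₚ runsEnd p rs) (corner-suc p rs k) (corner≤ₚrunsEnd p rs (suc k))))

  before⇒nonConflicting : ∀ {Δ} P Q → Before P Q → start Q ≤ₚ (m′ , m′) →
                          NonConflicting (multiseg {Δ} P) (multiseg Q)
  before⇒nonConflicting (p ▹ rs) (q ▹ rs′) P<Q q-inside i j = inj₂ λ c d c∈Q d∈P →
    let q≤c = subst (_≤ₚ ⌊ c ⌋) (⌊clampₚ⌋-inside q-inside) (proj₁ (segmentAt-bounds q rs′ (toℕ j) c∈Q))
        d≤P = proj₂ (segmentAt-bounds p rs (toℕ i) d∈P)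
        col< , row< = ≤ₚ-<ₚ-trans d≤P (<ₚ-≤ₚ-trans P<Q q≤c)
    in row< , col<

  sorted⇒nonConflicting : ∀ {Δ Ps} → AllPairs Before Ps → All (λ Q → start Q ≤ₚ (m′ , m′)) Ps →
                          AllPairs NonConflicting (map (multiseg {Δ}) Ps)
  sorted⇒nonConflicting {Ps = []}     []                 []              = []
  sorted⇒nonConflicting {Ps = P ∷ Ps} (P<Ps ∷ Ps-sorted) (_ ∷ Ps-inside) =
    All.map⁺ (All.zipWith (λ {Q} (P<Q , Q-inside) → before⇒nonConflicting P Q P<Q Q-inside) (P<Ps , Ps-inside))
    ∷ sorted⇒nonConflicting Ps-sorted Ps-inside

  inPieces⇒1≤coverCount : ∀ {Δ Ps} → All (λ P → length (runs P) < Δ) Ps → ∀ c →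
                          Any (InPiece ⌊ c ⌋) Ps → 1 ≤ coverCount (map (multiseg {Δ}) Ps) c
  inPieces⇒1≤coverCount {Ps = P ∷ Ps} (P-short ∷ _) c (here c∈P) =
    covers⇒1≤coverCount (multiseg P) (map multiseg Ps) (inPiece⇒covers P P-short c c∈P)
  inPieces⇒1≤coverCount {Ps = P ∷ Ps} (_ ∷ Ps-short) c (there c∈Ps) =
    ℕ.≤-trans (inPieces⇒1≤coverCount Ps-short c c∈Ps) (ℕ.m≤n+m _ _)

allCells-complete : ∀ {m} (c : Cell m) → c ∈ allCells m
allCells-complete {m} (x , y) =
  ∈-concatMap⁺ (λ x′ → map (x′ ,_) (allFin m))
               (Any.map (λ { refl → ∈-map⁺ (x ,_) (∈-allFin y) }) (∈-allFin x))

module Weighted {m} (w : Weights m) (w≥0 : ∀ c → 0ℚ ≤ℚ w c) where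

  weigh : (Cell m → ℕ) → ℚ
  weigh g = sumℚ (map (λ c → g c · w c) (allCells m))

  weigh-zero : weigh (λ _ → 0) ≡ 0ℚ
  weigh-zero = sumℚ-zero (allCells m)

  weigh-+ : ∀ f g → weigh (λ c → f c + g c) ≡ weigh f +ℚ weigh g
  weigh-+ f g = trans (cong sumℚ (map-cong (λ c → ×-homo-+ (w c) (f c) (g c)) (allCells m)))
                      (sumℚ-+ (λ c → f c · w c) (λ c → g c · w c) (allCells m))

  weigh-∑ : ∀ n (g : ℕ → Cell m → ℕ) → weigh (λ c → ∑ℕ n (λ r → g r c)) ≡ ∑ℚ n (λ r → weigh (g r))
  weigh-∑ zero    g = weigh-zero
  weigh-∑ (suc n) g = trans (weigh-+ (g n) _) (cong (weigh (g n) +ℚ_) (weigh-∑ n g))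

  weigh-mono : ∀ {f g} → (∀ c → f c ≤ g c) → weigh f ≤ℚ weigh g
  weigh-mono f≤g = sumℚ-mono (λ c → ·-monoˡ-≤ (w≥0 c) (f≤g c)) (allCells m)

  weigh-nonNeg : ∀ g → 0ℚ ≤ℚ weigh g
  weigh-nonNeg g = sumℚ-nonNeg (λ c → ·-nonNeg (g c) (w≥0 c)) (allCells m)

  weightAt≤weigh-δ : ∀ x y → weightAt w x y ≤ℚ weigh (λ c → δ (x , y) ⌊ c ⌋)
  weightAt≤weigh-δ x y with x ℕ.<? m | y ℕ.<? m
  ... | yes x<m | yes y<m =
    subst (_≤ℚ weigh (λ c → δ (x , y) ⌊ c ⌋))
          (trans (cong (_· w cell) δ≡1) (ℚ.+-identityʳ (w cell)))
          (∈⇒≤sumℚ (λ c → ·-nonNeg (δ (x , y) ⌊ c ⌋) (w≥0 c)) (allCells-complete cell))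
    where
    cell = fromℕ< x<m , fromℕ< y<m
    δ≡1 : δ (x , y) ⌊ cell ⌋ ≡ 1
    δ≡1 = cong (if_then 1 else 0)
                 (dec-true ((x , y) ≟ₚ ⌊ cell ⌋) (sym (cong₂ _,_ (toℕ-fromℕ< x<m) (toℕ-fromℕ< y<m))))
  ... | yes _ | no _ = weigh-nonNeg (λ c → δ (x , y) ⌊ c ⌋)
  ... | no _  | _    = weigh-nonNeg (λ c → δ (x , y) ⌊ c ⌋)

  pathSum≤weigh-visits : ∀ x y u → pathSumFrom w x y u ≤ℚ weigh (λ c → visits (x , y) u ⌊ c ⌋)
  pathSum≤weigh-visits x y []          = weightAt≤weigh-δ x y
  pathSum≤weigh-visits x y (true  ∷ u) =
    subst (pathSumFrom w x y (true ∷ u) ≤ℚ_)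
          (sym (weigh-+ (λ c → δ (x , y) ⌊ c ⌋) (λ c → visits (suc x , y) u ⌊ c ⌋)))
          (ℚ.+-mono-≤ (weightAt≤weigh-δ x y) (pathSum≤weigh-visits (suc x) y u))
  pathSum≤weigh-visits x y (false ∷ u) =
    subst (pathSumFrom w x y (false ∷ u) ≤ℚ_)
          (sym (weigh-+ (λ c → δ (x , y) ⌊ c ⌋) (λ c → visits (x , suc y) u ⌊ c ⌋)))
          (ℚ.+-mono-≤ (weightAt≤weigh-δ x y) (pathSum≤weigh-visits x (suc y) u))

  value≡weigh : ∀ {Δ} (S : Multiseg m Δ) → value w S ≡ weigh (λ c → if coversᵇ S c then 1 else 0)
  value≡weigh S = cong sumℚ (map-cong covered-weight (allCells m))
    where
    covered-weight : ∀ c → (if coversᵇ S c then w c else 0ℚ) ≡ (if coversᵇ S c then 1 else 0) · w c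
    covered-weight c with coversᵇ S c
    ... | true  = sym (ℚ.+-identityʳ (w c))
    ... | false = refl

  totalValue≡weigh : ∀ {Δ} (Ss : List (Multiseg m Δ)) → totalValue w Ss ≡ weigh (coverCount Ss)
  totalValue≡weigh []       = sym weigh-zero
  totalValue≡weigh (S ∷ Ss) =
    trans (cong₂ _+ℚ_ (value≡weigh S) (totalValue≡weigh Ss))
          (sym (weigh-+ (λ c → if coversᵇ S c then 1 else 0) (coverCount Ss)))

words-length : ∀ n → All (λ u → length u ≡ n) (words n)
words-length zero    = refl ∷ []
words-length (suc n) = All.++⁺ (All.map⁺ (All.map (cong suc) (words-length n)))
                               (All.map⁺ (All.map (cong suc) (words-length n)))

path-ends-at-corner : ∀ m′ u → u ∈ paths (suc m′) →
                      uncurry (zigzagEnd (0 , 0)) (zigzag u) ≡ (m′ , m′)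
path-ends-at-corner m′ u u∈paths = begin
  uncurry (zigzagEnd (0 , 0)) (zigzag u) ≡⟨ zigzagEnd-zigzag u 0 0 ⟩
  (countRight u + 0 , countUp u + 0)     ≡⟨ cong₂ _,_ (ℕ.+-identityʳ _) (ℕ.+-identityʳ _) ⟩
  (countRight u , countUp u)             ≡⟨ cong₂ _,_ rights ups ⟩
  (m′ , m′)                              ∎
  where
  open ≡-Reasoning
  isWord×rights = ∈-filter⁻ (T? ∘ λ v → countRight v ℕ.≡ᵇ m′) {xs = words (2 ℕ.* m′)} u∈paths
  rights : countRight u ≡ m′
  rights = ℕ.≡ᵇ⇒≡ _ _ (proj₂ isWord×rights)
  ups : countUp u ≡ m′
  ups = ℕ.+-cancelˡ-≡ m′ _ _ (begin
    m′ + countUp u         ≡⟨ cong (_+ countUp u) (sym rights) ⟩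
    countRight u + countUp u ≡⟨ countRight+countUp u ⟩
    length u               ≡⟨ All.lookup (words-length (2 ℕ.* m′)) (proj₁ isWord×rights) ⟩
    m′ + (m′ + 0)          ≡⟨ cong (m′ +_) (ℕ.+-identityʳ m′) ⟩
    m′ + m′                ∎)

score-attained : ∀ {m} (w : Weights m) →
                 score w ≡ 0ℚ ⊎ ∃ λ u → u ∈ paths m × score w ≡ pathSumFrom w 0 0 u
score-attained {m} w with foldr-selective ℚ.⊔-sel 0ℚ (map (pathSumFrom w 0 0) (paths m))
... | inj₁ score≡0     = inj₁ score≡0
... | inj₂ score∈sums = inj₂ (∈-map⁻ (pathSumFrom w 0 0) score∈sums)

module _ (m′ D : ℕ) (w : Weights (suc m′)) (w≥0 : ∀ c → 0ℚ ≤ℚ w c)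
         (u : List Bool) (u-ends-inside : uncurry (zigzagEnd (0 , 0)) (zigzag u) ≤ₚ (m′ , m′)) where

  open Families D
  open Table m′
  open Weighted w w≥0

  d = proj₁ (zigzag u)
  ns = proj₂ (zigzag u)

  multisegs : ℕ → List (Multiseg (suc m′) Δ)
  multisegs r = map multiseg (family r (0 , 0) d ns)

  multisegs-nonConflicting : ∀ r → AllPairs NonConflicting (multisegs r)
  multisegs-nonConflicting r = sorted⇒nonConflicting (family-sorted r (0 , 0) d ns)
    (All.map (λ ≤end → ≤ₚ-trans ≤end u-ends-inside) (family-starts-≤end r (0 , 0) d ns))

  family-short : ∀ {r} → r < Δ → All (λ P → length (runs P) < Δ) (family r (0 , 0) d ns)
  family-short r<Δ = All.map s≤s (family-length (ℕ.≤-pred r<Δ) (0 , 0) d ns)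

  visited⇒covered : ∀ c → 1 ≤ visits (0 , 0) u ⌊ c ⌋ →
                    ∃ λ r₀ → ∀ r → r < Δ → r ≢ r₀ → 1 ≤ coverCount (multisegs r) c
  visited⇒covered c visited with visited⇒InRun (0 , 0) u ⌊ c ⌋ visited
  ... | inj₁ c≡origin  = 0 , λ r r<Δ _ →
    inPieces⇒1≤coverCount (family-short r<Δ) c (here (at-start c≡origin))
  ... | inj₂ (j , c∈j) = j ℕ.% Δ , λ r r<Δ r≢j%Δ →
    inPieces⇒1≤coverCount (family-short r<Δ) c
      (family-covers r (0 , 0) d ns c∈j λ t j≡ → r≢j%Δ (begin
        r                 ≡⟨ sym (ℕ.m<n⇒m%n≡m r<Δ) ⟩
        r ℕ.% Δ           ≡⟨ sym (ℕ.[m+kn]%n≡m%n r t Δ) ⟩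
        (r + t ℕ.* Δ) ℕ.% Δ ≡⟨ cong (ℕ._% Δ) (sym j≡) ⟩
        j ℕ.% Δ           ∎))
    where open ≡-Reasoning

  covered-often : ∀ c → ∑ℕ (suc D) (λ _ → visits (0 , 0) u ⌊ c ⌋) ≤
                        ∑ℕ Δ (λ r → coverCount (multisegs r) c)
  covered-often c with visits (0 , 0) u ⌊ c ⌋ in visits≡ | visits≤1 (0 , 0) u ⌊ c ⌋
  ... | 0 | _ = subst (_≤ ∑ℕ Δ (λ r → coverCount (multisegs r) c))
                      (sym (trans (∑ℕ-const (suc D) 0) (ℕ.*-zeroʳ (suc D)))) z≤n
  ... | 1 | _ = let r₀ , covered = visited⇒covered c (ℕ.≤-reflexive (sym visits≡)) in
    subst (_≤ ∑ℕ Δ (λ r → coverCount (multisegs r) c))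
          (sym (trans (∑ℕ-const (suc D) 1) (ℕ.*-identityʳ (suc D))))
          (n∸1≤∑ℕ Δ (λ r → coverCount (multisegs r) c) r₀ covered)
  ... | suc (suc _) | s≤s ()

  path≤∑families : suc D · pathSumFrom w 0 0 u ≤ℚ ∑ℚ Δ (λ r → totalValue w (multisegs r))
  path≤∑families = begin
    suc D · pathSumFrom w 0 0 u                 ≤⟨ ·-monoʳ-≤ (suc D) (pathSum≤weigh-visits 0 0 u) ⟩
    suc D · weigh visited                       ≡⟨ sym (∑ℚ-const (suc D) (weigh visited)) ⟩
    ∑ℚ (suc D) (λ _ → weigh visited)            ≡⟨ sym (weigh-∑ (suc D) (λ _ → visited)) ⟩
    weigh (λ c → ∑ℕ (suc D) (λ _ → visited c))  ≤⟨ weigh-mono covered-often ⟩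
    weigh (λ c → ∑ℕ Δ (λ r → coverCount (multisegs r) c))
                                                ≡⟨ weigh-∑ Δ (coverCount ∘ multisegs) ⟩
    ∑ℚ Δ (λ r → weigh (coverCount (multisegs r)))
                                                ≡⟨ ∑ℚ-cong Δ (λ r → sym (totalValue≡weigh (multisegs r))) ⟩
    ∑ℚ Δ (λ r → totalValue w (multisegs r))     ∎
    where
    open ℚ.≤-Reasoning
    visited : Cell (suc m′) → ℕ
    visited c = visits (0 , 0) u ⌊ c ⌋

  best-family : ∃ λ (Ss : List (Multiseg (suc m′) Δ)) → AllPairs NonConflicting Ss ×
                suc D · pathSumFrom w 0 0 u ≤ℚ Δ · totalValue w Ss
  best-family =
    let r , _ , ∑≤ = ∑ℚ≤·max (suc D) (λ r → totalValue w (multisegs r))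
    in multisegs r , multisegs-nonConflicting r , ℚ.≤-trans path≤∑families ∑≤

lemma4p1 : (m Δ : ℕ) → 1 ≤ m → 1 ≤ Δ → (w : Weights m) → (∀ c → 0ℚ ≤ℚ w c) →
    ∃ λ (Ss : List (Multiseg m Δ)) → AllPairs NonConflicting Ss ×
      (ℕtoℚ (Δ ∸ 1) * score w ≤ℚ ℕtoℚ Δ * totalValue w Ss)
lemma4p1 (suc m′) 1 _ _ w _ = [] , [] , ℚ.≤-reflexive (trans (ℚ.*-zeroˡ (score w)) (sym (ℚ.*-zeroʳ 1ℚ)))
lemma4p1 (suc m′) (suc (suc D)) _ _ w w≥0 with score-attained w
... | inj₁ score≡0 = [] , [] , ℚ.≤-reflexive (begin
  ℕtoℚ (suc D) * score w  ≡⟨ cong (ℕtoℚ (suc D) *_) score≡0 ⟩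
  ℕtoℚ (suc D) * 0ℚ       ≡⟨ ℚ.*-zeroʳ (ℕtoℚ (suc D)) ⟩
  0ℚ                      ≡⟨ sym (ℚ.*-zeroʳ (ℕtoℚ (suc (suc D)))) ⟩
  ℕtoℚ (suc (suc D)) * 0ℚ ∎)
  where open ≡-Reasoning
... | inj₂ (u , u∈paths , score≡) =
  let u-ends-inside = subst (_≤ₚ (m′ , m′)) (sym (path-ends-at-corner m′ u u∈paths)) ≤ₚ-refl
      Ss , nonConflicting , bound = best-family m′ D w w≥0 u u-ends-inside
  in Ss , nonConflicting ,
     subst₂ _≤ℚ_ (sym (trans (cong (ℕtoℚ (suc D) *_) score≡) (ℕtoℚ*≡· (suc D) _)))
                 (sym (ℕtoℚ*≡· (suc (suc D)) (totalValue w Ss))) bound
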